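{- There is a deterministic PSA for $FVS(k)$ which uses $O(nk)$ space, where $n$ is the number of vertices: i.e., a deterministic one-pass algorithm over an insertion-only stream of edges of a graph on $n$ vertices that maintains $O(nk)$ space and, from what it stores, either outputs a feedback vertex set of size at most $k$ of the graph seen so far or correctly reports that none exists.
   Context: Feedback Vertex Set $FVS(k)$: given a graph $G=(V,E)$ and an integer $k$, decide whether there is a set $V'\subseteq V$ with $|V'|\le k$ such that $G\setminus V'$ has no cycles (and find one). A PSA (parameterized streaming algorithm) is a one-pass streaming algorithm that maintains a sketch from which, at query time, a solution of size at most $k$ for the current graph is extracted or it is reported that none exists. -}

module Defs where

open import Data.Nat using (ℕ; zero; suc; _+_; _*_; _^_; _≤_; _<_; _≥_)
open import Data.Fin using (Fin)
open import Data.List using (List; []; _∷_; length; foldl; last; head)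
open import Data.List.Membership.Propositional using (_∈_; _∉_)
open import Data.List.Relation.Unary.All using (All)
open import Data.List.Relation.Unary.Unique.Propositional using (Unique)
open import Data.Maybe using (Maybe; just; nothing)
open import Data.Product using (_×_; _,_; ∃; Σ)
open import Relation.Binary.PropositionalEquality using (_≡_; _≢_)
open import Relation.Nullary using (¬_)

-- An edge of a graph on vertex set Fin n: an unordered pair {u,v}, u ≠ v,
-- given by an (ordered) representative.
record Edge (n : ℕ) : Set where
  constructor edge
  field
    u v   : Fin n
    u≢v   : u ≢ v

-- An insertion-only stream of edges (the graph seen so far). The graph it
-- determines has vertex set Fin n and edge set = the edges occurring in it.
Stream : ℕ → Set
Stream n = List (Edge n)

Adj : ∀ {n} → Stream n → Fin n → Fin n → Set
Adj {n} E x y = ∃ λ (e : Edge n) → e ∈ E × ((Edge.u e ≡ x × Edge.v e ≡ y) ⊎' (Edge.u e ≡ y × Edge.v e ≡ x))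
  where
  open import Data.Sum using () renaming (_⊎_ to _⊎'_)

data Path {n} (E : Stream n) : List (Fin n) → Set where
  [] : Path E []
  [-] : ∀ x → Path E (x ∷ [])
  step : ∀ {x y xs} → Adj E x y → Path E (y ∷ xs) → Path E (x ∷ y ∷ xs)

record Cycle {n} (E : Stream n) (c : List (Fin n)) : Set where
  field
    len≥3    : length c ≥ 3
    distinct : Unique c
    path     : Path E c
    closing  : ∃ λ x → ∃ λ y → head c ≡ just x × last c ≡ just y × Adj E y x

AcyclicWithout : ∀ {n} → Stream n → List (Fin n) → Set
AcyclicWithout E S = ∀ c → Cycle E c → ¬ All (_∉ S) c

IsFVS : ∀ {n} → Stream n → ℕ → List (Fin n) → Set
IsFVS E k S = length S ≤ k × AcyclicWithout E S

-- A deterministic one-pass streaming algorithm for graphs on n vertices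
-- with parameter k. Its memory is a list of machine words (natural numbers).
record StreamAlg (n : ℕ) : Set where
  field
    init   : List ℕ
    update : List ℕ → Edge n → List ℕ
    query  : List ℕ → Maybe (List (Fin n))

  run : Stream n → List ℕ
  run = foldl update init

Correct : ∀ {n} → ℕ → Stream n → Maybe (List (Fin n)) → Set
Correct k E (just S) = IsFVS E k S
Correct k E nothing  = ∀ S → ¬ IsFVS E k S

-- Space bound: at every point of every stream the memory holds at most
-- C·n·(k+1) words, each word being < (n+1)^c (i.e. O(log n) bits).
-- Query-time answer is correct for the graph seen so far.
IsPSA-FVS : ∀ {n} → ℕ → ℕ → ℕ → StreamAlg n → Set
IsPSA-FVS {n} k C c A =
  ∀ (s : Stream n) →
    length (run s) ≤ C * n * suc k
    × All (_< suc n ^ c) (run s)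
    × Correct k s (query (run s))
  where open StreamAlg A

-- The combinatorial heart is `edges-bounded-by-fvs`: a simple graph on
-- n vertices with a feedback vertex set S, |S| ≤ k, has at most n(k+1)
-- edges.  Each vertex of S meets at most n edges (its neighbours are
-- distinct), and the edges avoiding S form a forest on at most n
-- vertices, hence number fewer than n.  The forest bound is
-- `many-edges-force-cycle`: a simple graph whose edges live on a vertex
-- list W and number at least |W| has a cycle inside W -- if every vertex
-- has degree ≥ 2 a non-backtracking walk closes a cycle (`close-walk`),
-- otherwise a vertex of degree ≤ 1 is deleted and we recurse.
--
-- The algorithm stores the distinct edges seen so far, two words each.
-- When a new edge would exceed n(k+1) stored edges, the bound shows that
-- no solution exists, and the memory collapses to a one-word rejection
-- marker that persists.  At query time the stored graph, which has the
-- same adjacency as the stream, is solved by exhaustive search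
-- (`decide-fvs`).
module Submission where

open import Defs
open import Data.Nat using (ℕ; zero; suc; _+_; _*_; _^_; _≤_; _<_; z≤n; s≤s)
open import Data.Nat.Properties
open import Data.Fin using (Fin; toℕ; fromℕ<) renaming (_≟_ to _≟F_)
open import Data.Fin.Properties using (toℕ<n; fromℕ<-toℕ; ¬Fin0)
open import Data.List using (List; []; _∷_; length; foldl; last; head; filter; allFin; map; concat; _++_)
open import Data.List.Properties using (filter-notAll; filter-none; length-filter; length-tabulate; ++-identityʳ; ++-assoc)
open import Data.List.Membership.Propositional using (_∈_; _∉_; find; lose)
open import Data.List.Membership.Propositional.Properties using (∈-filter⁺; ∈-filter⁻; ∈-allFin; ∈-++⁺ˡ; ∈-++⁺ʳ; ∈-++⁻; ∈-map⁺; ∈-concat⁺′)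
import Data.List.Membership.DecPropositional as DecMembership
open import Data.List.Relation.Unary.All as All using (All; []; _∷_)
open import Data.List.Relation.Unary.All.Properties using (¬Any⇒All¬)
open import Data.List.Relation.Unary.Any as Any using (here; there; any?)
open import Data.List.Relation.Unary.AllPairs using (AllPairs; []; _∷_)
open import Data.List.Relation.Unary.AllPairs.Properties as AllPairs using ()
open import Data.List.Relation.Unary.Unique.Propositional using (Unique)
open import Data.List.Relation.Unary.Unique.DecPropositional using (unique?)
open import Data.Maybe using (Maybe; just; nothing; maybe′)
open import Data.Maybe.Properties using (just-injective)
open import Data.Product using (_×_; _,_; ∃; ∃₂; Σ; proj₁; proj₂)
open import Data.Sum using (_⊎_; inj₁; inj₂; [_,_]′)
open import Data.Empty using (⊥-elim)
open import Relation.Binary.Definitions using (DecidableEquality)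
open import Relation.Binary.PropositionalEquality using (_≡_; _≢_; refl; sym; trans; cong; subst; subst₂)
open import Relation.Nullary using (¬_; Dec; yes; no; ¬?)
open import Relation.Nullary.Decidable using (_⊎-dec_; _×-dec_; map′)
open import Relation.Unary using (Decidable)

open Edge

_∈?_ : ∀ {n} (x : Fin n) (xs : List (Fin n)) → Dec (x ∈ xs)
_∈?_ = DecMembership._∈?_ _≟F_

unique-length-≤ : ∀ {A : Set} → DecidableEquality A → {xs ys : List A} →
  Unique xs → (∀ {x} → x ∈ xs → x ∈ ys) → length xs ≤ length ys
unique-length-≤ _≟_ {[]} _ _ = z≤n
unique-length-≤ _≟_ {x ∷ xs} {ys} (x∉xs ∷ uniq) xs⊆ys =
  ≤-trans (s≤s (unique-length-≤ _≟_ uniq xs⊆rest))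
          (filter-notAll Not-x? ys (Any.map (λ x≡y x≢y → x≢y x≡y) (xs⊆ys (here refl))))
  where
  Not-x? = λ y → ¬? (x ≟ y)
  xs⊆rest : ∀ {y} → y ∈ xs → y ∈ filter Not-x? ys
  xs⊆rest y∈xs = ∈-filter⁺ Not-x? (xs⊆ys (there y∈xs)) (All.lookup x∉xs y∈xs)

unique-fin-length-≤ : ∀ {n} {xs : List (Fin n)} → Unique xs → length xs ≤ n
unique-fin-length-≤ {n} {xs} uniq =
  subst (length xs ≤_) (length-tabulate {n = n} (λ i → i))
        (unique-length-≤ _≟F_ uniq (λ {x} _ → ∈-allFin x))

filter-split-length : ∀ {A : Set} {P : A → Set} (P? : Decidable P) (xs : List A) →
  length (filter P? xs) + length (filter (λ x → ¬? (P? x)) xs) ≡ length xs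
filter-split-length P? [] = refl
filter-split-length P? (x ∷ xs) with P? x
... | yes _ = cong suc (filter-split-length P? xs)
... | no _ = trans (+-suc _ _) (cong suc (filter-split-length P? xs))

filter-cover-length : ∀ {A : Set} {P Q R : A → Set} (P? : Decidable P) (Q? : Decidable Q) (R? : Decidable R) →
  (∀ {x} → P x → Q x ⊎ R x) → ∀ xs →
  length (filter P? xs) ≤ length (filter Q? xs) + length (filter R? xs)
filter-cover-length P? Q? R? cover [] = z≤n
filter-cover-length P? Q? R? cover (x ∷ xs) with ih ← filter-cover-length P? Q? R? cover xs | P? x | Q? x | R? x
... | yes _ | yes _ | yes _ = s≤s (≤-trans ih (+-monoʳ-≤ (length (filter Q? xs)) (n≤1+n _)))
... | yes _ | yes _ | no _  = s≤s ih
... | yes _ | no _  | yes _ = subst (suc (length (filter P? xs)) ≤_) (sym (+-suc _ _)) (s≤s ih)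
... | yes p | no ¬q | no ¬r = ⊥-elim ([ ¬q , ¬r ]′ (cover p))
... | no _  | yes _ | yes _ = m≤n⇒m≤1+n (≤-trans ih (+-monoʳ-≤ (length (filter Q? xs)) (n≤1+n _)))
... | no _  | yes _ | no _  = m≤n⇒m≤1+n ih
... | no _  | no _  | yes _ = subst (length (filter P? xs) ≤_) (sym (+-suc _ _)) (m≤n⇒m≤1+n ih)
... | no _  | no _  | no _  = ih

two-members-length : ∀ {A : Set} {a b : A} {xs : List A} → a ∈ xs → b ∈ xs → a ≢ b → 2 ≤ length xs
two-members-length {xs = x ∷ []} (here a≡x) (here b≡x) a≢b = ⊥-elim (a≢b (trans a≡x (sym b≡x)))
two-members-length {xs = x ∷ y ∷ xs} _ _ _ = s≤s (s≤s z≤n)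

empty-or-member : ∀ {A : Set} (xs : List A) → xs ≡ [] ⊎ ∃ λ x → x ∈ xs
empty-or-member [] = inj₁ refl
empty-or-member (x ∷ xs) = inj₂ (x , here refl)

-- The prefix of xs ending at (and including) the member z.  It is used to
-- cut a cycle out of a walk that returns to one of its vertices.
prefix-to : ∀ {A : Set} {z : A} (xs : List A) → z ∈ xs → List A
prefix-to (x ∷ xs) (here _) = x ∷ []
prefix-to (x ∷ xs) (there z∈xs) = x ∷ prefix-to xs z∈xs

prefix-to-All : ∀ {A : Set} {P : A → Set} {z : A} {xs : List A} (z∈xs : z ∈ xs) → All P xs → All P (prefix-to xs z∈xs)
prefix-to-All (here _) (px ∷ _) = px ∷ []
prefix-to-All (there z∈xs) (px ∷ pxs) = px ∷ prefix-to-All z∈xs pxs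

prefix-to-Unique : ∀ {A : Set} {z : A} {xs : List A} (z∈xs : z ∈ xs) → Unique xs → Unique (prefix-to xs z∈xs)
prefix-to-Unique (here _) (_ ∷ _) = [] ∷ []
prefix-to-Unique (there z∈xs) (x∉ ∷ uniq) = prefix-to-All z∈xs x∉ ∷ prefix-to-Unique z∈xs uniq

prefix-to-last : ∀ {A : Set} {z : A} (xs : List A) (z∈xs : z ∈ xs) → last (prefix-to xs z∈xs) ≡ just z
prefix-to-last (x ∷ xs) (here z≡x) = cong just (sym z≡x)
prefix-to-last (x ∷ y ∷ ys) (there (here z≡y)) = prefix-to-last (y ∷ ys) (here z≡y)
prefix-to-last (x ∷ y ∷ ys) (there (there z∈)) = prefix-to-last (y ∷ ys) (there z∈)

prefix-to-nonempty : ∀ {A : Set} {z : A} (xs : List A) (z∈xs : z ∈ xs) → 1 ≤ length (prefix-to xs z∈xs)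
prefix-to-nonempty (x ∷ xs) (here _) = s≤s z≤n
prefix-to-nonempty (x ∷ xs) (there _) = s≤s z≤n

Joins : ∀ {n} → Edge n → Fin n → Fin n → Set
Joins e x y = (u e ≡ x × v e ≡ y) ⊎ (u e ≡ y × v e ≡ x)

Joins? : ∀ {n} (e : Edge n) x y → Dec (Joins e x y)
Joins? e x y = ((u e ≟F x) ×-dec (v e ≟F y)) ⊎-dec ((u e ≟F y) ×-dec (v e ≟F x))

Joins-sym : ∀ {n} {e : Edge n} {x y} → Joins e x y → Joins e y x
Joins-sym (inj₁ (a , b)) = inj₂ (a , b)
Joins-sym (inj₂ (a , b)) = inj₁ (a , b)

Adj-sym : ∀ {n} {E : Stream n} {x y} → Adj E x y → Adj E y x
Adj-sym (e , e∈E , j) = e , e∈E , Joins-sym {e = e} j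

Adj-≢ : ∀ {n} {E : Stream n} {x y} → Adj E x y → x ≢ y
Adj-≢ (e , _ , inj₁ (a , b)) x≡y = u≢v e (trans a (trans x≡y (sym b)))
Adj-≢ (e , _ , inj₂ (a , b)) x≡y = u≢v e (trans a (trans (sym x≡y) (sym b)))

-- E ⊆ᴬ E': every adjacency of E is one of E'.  Streams with the same
-- adjacency have the same cycles and the same feedback vertex sets.
_⊆ᴬ_ : ∀ {n} → Stream n → Stream n → Set
E ⊆ᴬ E' = ∀ {x y} → Adj E x y → Adj E' x y

⊆⇒⊆ᴬ : ∀ {n} {E E' : Stream n} → (∀ {e} → e ∈ E → e ∈ E') → E ⊆ᴬ E'
⊆⇒⊆ᴬ E⊆E' (e , e∈E , j) = e , E⊆E' e∈E , j

Path-mono : ∀ {n} {E E' : Stream n} → E ⊆ᴬ E' → ∀ {c} → Path E c → Path E' c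
Path-mono E⊆E' Path.[] = Path.[]
Path-mono E⊆E' ([-] x) = [-] x
Path-mono E⊆E' (step a p) = step (E⊆E' a) (Path-mono E⊆E' p)

Cycle-mono : ∀ {n} {E E' : Stream n} → E ⊆ᴬ E' → ∀ {c} → Cycle E c → Cycle E' c
Cycle-mono E⊆E' cyc = record
  { len≥3 = Cycle.len≥3 cyc ; distinct = Cycle.distinct cyc
  ; path = Path-mono E⊆E' (Cycle.path cyc)
  ; closing = let (x , y , hd , lst , a) = Cycle.closing cyc in x , y , hd , lst , E⊆E' a }

FVS-antitone : ∀ {n} {E E' : Stream n} → E ⊆ᴬ E' → ∀ {k S} → IsFVS E' k S → IsFVS E k S
FVS-antitone E⊆E' (|S|≤k , acyclic) = |S|≤k , λ c cyc → acyclic c (Cycle-mono E⊆E' cyc)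

SameEdge : ∀ {n} → Edge n → Edge n → Set
SameEdge e f = Joins f (u e) (v e)

Simple : ∀ {n} → Stream n → Set
Simple = AllPairs (λ e f → ¬ SameEdge e f)

Joins-same : ∀ {n} {x z : Fin n} {e f : Edge n} → Joins e x z → Joins f x z → SameEdge e f
Joins-same (inj₁ (refl , refl)) j = j
Joins-same {f = f} (inj₂ (refl , refl)) j = Joins-sym {e = f} j

Simple-cons : ∀ {n} {F : Stream n} (g : Edge n) → ¬ Adj F (u g) (v g) → Simple F → Simple (g ∷ F)
Simple-cons {F = F} g new simple = All.tabulate (λ f∈F same → new (_ , f∈F , same)) ∷ simple

Incident : ∀ {n} → Fin n → Edge n → Set
Incident w e = u e ≡ w ⊎ v e ≡ w

Incident? : ∀ {n} (w : Fin n) → Decidable (Incident w)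
Incident? w e = (u e ≟F w) ⊎-dec (v e ≟F w)

degree : ∀ {n} → Stream n → Fin n → ℕ
degree U w = length (filter (Incident? w) U)

incident-edges : ∀ {n} (U : Stream n) (w : Fin n) → All (Incident w) (filter (Incident? w) U)
incident-edges U w = All.tabulate (λ e∈ → proj₂ (∈-filter⁻ (Incident? w) {xs = U} e∈))

other-end : ∀ {n} {x : Fin n} (e : Edge n) → Incident x e → ∃ λ z → Joins e x z
other-end e (inj₁ u≡x) = v e , inj₁ (u≡x , refl)
other-end e (inj₂ v≡x) = u e , inj₂ (refl , v≡x)

avoiding-neighbour : ∀ {n} {x : Fin n} (L : Stream n) → Simple L → All (Incident x) L →
  2 ≤ length L → (y : Fin n) → ∃ λ z → ∃ λ e → e ∈ L × Joins e x z × z ≢ y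
avoiding-neighbour (p ∷ []) _ _ (s≤s ()) y
avoiding-neighbour (p ∷ q ∷ L) ((p≉q ∷ _) ∷ _) (ip ∷ iq ∷ _) _ y
  with other-end p ip | other-end q iq
... | zp , jp | zq , jq with zp ≟F y
... | no zp≢y = zp , p , here refl , jp , zp≢y
... | yes refl = zq , q , there (here refl) , jq ,
                 λ { refl → p≉q (Joins-same {e = p} {f = q} jp jq) }

-- In a simple graph, a vertex of degree ≥ 2 has a neighbour avoiding any
-- prescribed vertex y: this is what lets a walk continue without backtracking.
second-neighbour : ∀ {n} {U : Stream n} {x : Fin n} → Simple U → 2 ≤ degree U x →
  (y : Fin n) → ∃ λ z → Adj U x z × z ≢ y
second-neighbour {U = U} {x} simple deg≥2 y
  with avoiding-neighbour (filter (Incident? x) U) (AllPairs.filter⁺ (Incident? x) simple)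
                          (incident-edges U x) deg≥2 y
... | z , e , e∈ , j , z≢y = z , (e , proj₁ (∈-filter⁻ (Incident? x) {xs = U} e∈) , j) , z≢y

EdgesWithin : ∀ {n} → Stream n → List (Fin n) → Set
EdgesWithin U W = ∀ {e} → e ∈ U → u e ∈ W × v e ∈ W

Adj-within : ∀ {n} {U : Stream n} {W : List (Fin n)} → EdgesWithin U W → ∀ {x y} → Adj U x y → x ∈ W
Adj-within within (e , e∈U , inj₁ (u≡x , _)) = subst (_∈ _) u≡x (proj₁ (within e∈U))
Adj-within within (e , e∈U , inj₂ (_ , v≡x)) = subst (_∈ _) v≡x (proj₂ (within e∈U))

CycleWithin : ∀ {n} → Stream n → List (Fin n) → Set
CycleWithin U W = ∃ λ c → Cycle U c × All (_∈ W) c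

Path-prefix-to : ∀ {n} {E : Stream n} {z : Fin n} {xs : List (Fin n)} (z∈xs : z ∈ xs) → Path E xs → Path E (prefix-to xs z∈xs)
Path-prefix-to (here _) ([-] x) = [-] x
Path-prefix-to (here _) (step _ _) = [-] _
Path-prefix-to (there (here _)) (step a _) = step a ([-] _)
Path-prefix-to (there (there z∈)) (step a p) = step a (Path-prefix-to (there z∈) p)

-- If every vertex of W has degree ≥ 2, a simple path x ∷ y ∷ rest inside W
-- grows at its head x by a neighbour z ≠ y, until z reappears further
-- down the path and closes a cycle.  The fuel bounds the number of
-- steps: a simple path in Fin n cannot exceed n vertices.
close-walk : ∀ {n} {U : Stream n} {W : List (Fin n)} → Simple U → EdgesWithin U W →
  (∀ {w} → w ∈ W → 2 ≤ degree U w) →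
  ∀ fuel (x y : Fin n) rest → n < length (x ∷ y ∷ rest) + fuel →
  Unique (x ∷ y ∷ rest) → Path U (x ∷ y ∷ rest) → All (_∈ W) (x ∷ y ∷ rest) → CycleWithin U W
close-walk {n} _ _ _ zero x y rest n<len uniq _ _ =
  ⊥-elim (<⇒≱ n<len (subst (_≤ n) (sym (+-identityʳ _)) (unique-fin-length-≤ uniq)))
close-walk {n} {U} simple within deg≥2 (suc fuel) x y rest n<len uniq path inW
  with second-neighbour {U = U} {x = x} simple (deg≥2 (All.head inW)) y
... | z , x~z , z≢y with z ∈? (x ∷ y ∷ rest)
... | yes (here z≡x) = ⊥-elim (Adj-≢ x~z (sym z≡x))
... | yes (there (here z≡y)) = ⊥-elim (z≢y z≡y)
... | yes z∈@(there (there z∈rest)) =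
  prefix-to (x ∷ y ∷ rest) z∈ ,
  record { len≥3 = s≤s (s≤s (prefix-to-nonempty rest z∈rest))
         ; distinct = prefix-to-Unique z∈ uniq
         ; path = Path-prefix-to z∈ path
         ; closing = x , z , refl , prefix-to-last (x ∷ y ∷ rest) z∈ , Adj-sym x~z } ,
  prefix-to-All z∈ inW
... | no z∉ = close-walk simple within deg≥2 fuel z x (y ∷ rest)
                (subst (n <_) (+-suc _ fuel) n<len)
                (¬Any⇒All¬ _ z∉ ∷ uniq) (step (Adj-sym x~z) path) (Adj-within within (Adj-sym x~z) ∷ inW)

Off? : ∀ {n} (w : Fin n) → Decidable (λ e → ¬ Incident w e)
Off? w e = ¬? (Incident? w e)

Other? : ∀ {n} (w : Fin n) → Decidable (λ x → ¬ x ≡ w)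
Other? w x = ¬? (x ≟F w)

edges-off : ∀ {n} → Fin n → Stream n → Stream n
edges-off w U = filter (Off? w) U

drop-vertex : ∀ {n} → Fin n → List (Fin n) → List (Fin n)
drop-vertex w W = filter (Other? w) W

edges-off-length : ∀ {n} (w : Fin n) (U : Stream n) → degree U w ≤ 1 → length U ≤ length (edges-off w U) + 1
edges-off-length w U deg≤1 = begin
  length U                                ≡⟨ filter-split-length (Incident? w) U ⟨
  degree U w + length (edges-off w U)     ≤⟨ +-monoˡ-≤ _ deg≤1 ⟩
  1 + length (edges-off w U)              ≡⟨ +-comm 1 _ ⟩
  length (edges-off w U) + 1              ∎
  where open ≤-Reasoning

drop-vertex-length : ∀ {n} {w : Fin n} {W : List (Fin n)} → w ∈ W → suc (length (drop-vertex w W)) ≤ length W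
drop-vertex-length {w = w} {W} w∈W = filter-notAll (Other? w) W (Any.map (λ w≡x x≢w → x≢w (sym w≡x)) w∈W)

edges-off-within : ∀ {n} {w : Fin n} {U : Stream n} {W : List (Fin n)} →
  EdgesWithin U W → EdgesWithin (edges-off w U) (drop-vertex w W)
edges-off-within {w = w} {U} within e∈ with ∈-filter⁻ (Off? w) {xs = U} e∈
... | e∈U , off = ∈-filter⁺ (Other? w) (proj₁ (within e∈U)) (λ u≡w → off (inj₁ u≡w)) ,
                  ∈-filter⁺ (Other? w) (proj₂ (within e∈U)) (λ v≡w → off (inj₂ v≡w))

lift-cycle : ∀ {n} {w : Fin n} {U : Stream n} {W : List (Fin n)} →
  CycleWithin (edges-off w U) (drop-vertex w W) → CycleWithin U W
lift-cycle {w = w} {U} {W} (c , cyc , inW) =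
  c , Cycle-mono (⊆⇒⊆ᴬ (λ e∈ → proj₁ (∈-filter⁻ (Off? w) {xs = U} e∈))) cyc ,
  All.map (λ x∈ → proj₁ (∈-filter⁻ (Other? w) {xs = W} x∈)) inW

-- Induction on a bound m for |W|: without a vertex of
-- degree ≤ 1 a walk closes a cycle, otherwise such a vertex is deleted.
many-edges-force-cycle : ∀ {n} m (W : List (Fin n)) (U : Stream n) → length W ≤ m → Simple U →
  EdgesWithin U W → (∃ λ e → e ∈ U) → length W ≤ length U → CycleWithin U W
many-edges-force-cycle {n} m W U |W|≤m simple within (e₀ , e₀∈U) |W|≤|U|
  with any? (λ w → degree U w ≤? 1) W
... | no no-leaf = close-walk simple within deg≥2 n (v e₀) (u e₀) [] (s≤s (n≤1+n n))
      (((λ v≡u → u≢v e₀ (sym v≡u)) ∷ []) ∷ [] ∷ [])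
      (step (e₀ , e₀∈U , inj₂ (refl , refl)) ([-] _))
      (proj₂ (within e₀∈U) ∷ proj₁ (within e₀∈U) ∷ [])
  where
  deg≥2 : ∀ {w} → w ∈ W → 2 ≤ degree U w
  deg≥2 w∈W = ≰⇒> (All.lookup (¬Any⇒All¬ W no-leaf) w∈W)
many-edges-force-cycle zero [] U _ _ within (e₀ , e₀∈U) _ | yes _ with () ← proj₁ (within e₀∈U)
many-edges-force-cycle (suc m) W U |W|≤m simple within (e₀ , e₀∈U) |W|≤|U| | yes some-leaf
  with find some-leaf
... | w , w∈W , deg≤1 with empty-or-member (edges-off w U)
... | inj₁ none-left = ⊥-elim (<⇒≱ (≤-trans two≤|W| |W|≤|U|)
                         (subst (λ U' → length U ≤ length U' + 1) none-left (edges-off-length w U deg≤1)))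
  where
  two≤|W| : 2 ≤ length W
  two≤|W| = two-members-length (proj₁ (within e₀∈U)) (proj₂ (within e₀∈U)) (u≢v e₀)
... | inj₂ some-left = lift-cycle {w = w} (many-edges-force-cycle m (drop-vertex w W) (edges-off w U)
        (≤-pred (≤-trans (drop-vertex-length w∈W) |W|≤m)) (AllPairs.filter⁺ (Off? w) simple)
        (edges-off-within within) some-left |W'|≤|U'|)
  where
  |W'|≤|U'| : length (drop-vertex w W) ≤ length (edges-off w U)
  |W'|≤|U'| = ≤-pred (begin
    suc (length (drop-vertex w W)) ≤⟨ drop-vertex-length w∈W ⟩
    length W                       ≤⟨ |W|≤|U| ⟩
    length U                       ≤⟨ edges-off-length w U deg≤1 ⟩
    length (edges-off w U) + 1     ≡⟨ +-comm _ 1 ⟩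
    suc (length (edges-off w U))   ∎)
    where open ≤-Reasoning

other-ends : ∀ {n} {s : Fin n} (L : Stream n) → All (Incident s) L → List (Fin n)
other-ends [] [] = []
other-ends (e ∷ L) (i ∷ is) = proj₁ (other-end e i) ∷ other-ends L is

other-ends-length : ∀ {n} {s : Fin n} (L : Stream n) (is : All (Incident s) L) → length (other-ends L is) ≡ length L
other-ends-length [] [] = refl
other-ends-length (e ∷ L) (i ∷ is) = cong suc (other-ends-length L is)

other-ends-Unique : ∀ {n} {s : Fin n} (L : Stream n) (is : All (Incident s) L) → Simple L → Unique (other-ends L is)
other-ends-Unique [] [] [] = []
other-ends-Unique {s = s} (e ∷ L) (i ∷ is) (e≉L ∷ simple) = fresh L is e≉L ∷ other-ends-Unique L is simple
  where
  z = proj₁ (other-end e i)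
  fresh : (L : Stream _) (is : All (Incident s) L) → All (λ f → ¬ SameEdge e f) L → All (z ≢_) (other-ends L is)
  fresh [] [] [] = []
  fresh (f ∷ L) (i' ∷ is) (e≉f ∷ e≉L) =
    (λ z≡z' → e≉f (Joins-same {e = e} {f = f} (proj₂ (other-end e i))
                    (subst (Joins f s) (sym z≡z') (proj₂ (other-end f i'))))) ∷ fresh L is e≉L

degree-≤ : ∀ {n} (F : Stream n) (s : Fin n) → Simple F → degree F s ≤ n
degree-≤ F s simple = subst (_≤ _) (other-ends-length L is) (unique-fin-length-≤ (other-ends-Unique L is (AllPairs.filter⁺ (Incident? s) simple)))
  where
  L = filter (Incident? s) F
  is = incident-edges F s

Meets : ∀ {n} → List (Fin n) → Edge n → Set
Meets S e = u e ∈ S ⊎ v e ∈ S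

Meets? : ∀ {n} (S : List (Fin n)) → Decidable (Meets S)
Meets? S e = (u e ∈? S) ⊎-dec (v e ∈? S)

meeting-edges-≤ : ∀ {n} (F : Stream n) → Simple F → ∀ S → length (filter (Meets? S) F) ≤ length S * n
meeting-edges-≤ F simple [] = ≤-reflexive (cong length (filter-none (Meets? []) {xs = F} (All.tabulate (λ _ → λ { (inj₁ ()) ; (inj₂ ()) }))))
meeting-edges-≤ {n} F simple (s ∷ S) =
  ≤-trans (filter-cover-length (Meets? (s ∷ S)) (Incident? s) (Meets? S) (λ {e} → split {e}) F)
          (+-mono-≤ (degree-≤ F s simple) (meeting-edges-≤ F simple S))
  where
  split : ∀ {e} → Meets (s ∷ S) e → Incident s e ⊎ Meets S e
  split (inj₁ (here u≡s)) = inj₁ (inj₁ u≡s)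
  split (inj₁ (there u∈S)) = inj₂ (inj₁ u∈S)
  split (inj₂ (here v≡s)) = inj₁ (inj₂ v≡s)
  split (inj₂ (there v∈S)) = inj₂ (inj₂ v∈S)

-- The edges of F avoiding S live on the vertices outside S.  If S is a
-- feedback vertex set they form a forest, so there are at most n of them.
module Avoiding {n} (F : Stream n) (S : List (Fin n)) where

  Avoids? : Decidable (λ e → ¬ Meets S e)
  Avoids? e = ¬? (Meets? S e)

  Outside? : Decidable (λ x → ¬ x ∈ S)
  Outside? x = ¬? (x ∈? S)

  avoiding : Stream n
  avoiding = filter Avoids? F

  outside : List (Fin n)
  outside = filter Outside? (allFin n)

  outside-length : length outside ≤ n
  outside-length = subst (length outside ≤_) (length-tabulate {n = n} (λ i → i)) (length-filter Outside? (allFin n))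

  avoiding-within : EdgesWithin avoiding outside
  avoiding-within e∈ with ∈-filter⁻ Avoids? {xs = F} e∈
  ... | _ , avoids = ∈-filter⁺ Outside? (∈-allFin _) (λ u∈S → avoids (inj₁ u∈S)) ,
                     ∈-filter⁺ Outside? (∈-allFin _) (λ v∈S → avoids (inj₂ v∈S))

  avoiding-edges-≤ : Simple F → AcyclicWithout F S → length avoiding ≤ n
  avoiding-edges-≤ simple acyclic with empty-or-member avoiding
  ... | inj₁ none rewrite none = z≤n
  ... | inj₂ some with length outside ≤? length avoiding
  ... | no few = ≤-trans (<⇒≤ (≰⇒> few)) outside-length
  ... | yes many with many-edges-force-cycle (length outside) outside avoiding ≤-refl
                        (AllPairs.filter⁺ Avoids? simple) avoiding-within some many
  ... | c , cyc , inW = ⊥-elim (acyclic c (Cycle-mono (⊆⇒⊆ᴬ (λ e∈ → proj₁ (∈-filter⁻ Avoids? {xs = F} e∈))) cyc)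
                                  (All.map (λ x∈ → proj₂ (∈-filter⁻ Outside? {xs = allFin n} x∈)) inW))

edges-bounded-by-fvs : ∀ {n} k (F : Stream n) S → Simple F → IsFVS F k S → length F ≤ n * suc k
edges-bounded-by-fvs {n} k F S simple (|S|≤k , acyclic) = begin
  length F                                                          ≡⟨ filter-split-length (Meets? S) F ⟨
  length (filter (Meets? S) F) + length (Avoiding.avoiding F S)     ≤⟨ +-mono-≤ meeting (Avoiding.avoiding-edges-≤ F S simple acyclic) ⟩
  k * n + n                                                         ≡⟨ +-comm (k * n) n ⟩
  n + k * n                                                         ≡⟨ cong (n +_) (*-comm k n) ⟩
  n + n * k                                                         ≡⟨ *-suc n k ⟨
  n * suc k                                                         ∎
  where
  open ≤-Reasoning
  meeting : length (filter (Meets? S) F) ≤ k * n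
  meeting = ≤-trans (meeting-edges-≤ F simple S) (*-monoˡ-≤ n |S|≤k)

lists-upto : ∀ {n} → ℕ → List (List (Fin n))
lists-upto zero = [] ∷ []
lists-upto {n} (suc m) = [] ∷ concat (map (λ x → map (x ∷_) (lists-upto m)) (allFin n))

lists-upto-complete : ∀ {n} m (xs : List (Fin n)) → length xs ≤ m → xs ∈ lists-upto m
lists-upto-complete zero [] _ = here refl
lists-upto-complete (suc m) [] _ = here refl
lists-upto-complete {n} (suc m) (x ∷ xs) (s≤s |xs|≤m) =
  there (∈-concat⁺′ (∈-map⁺ (x ∷_) (lists-upto-complete m xs |xs|≤m))
                    (∈-map⁺ (λ y → map (y ∷_) (lists-upto m)) (∈-allFin x)))

Adj? : ∀ {n} (F : Stream n) x y → Dec (Adj F x y)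
Adj? F x y = map′ find (λ (e , e∈F , j) → lose e∈F j) (any? (λ e → Joins? e x y) F)

Path? : ∀ {n} (F : Stream n) c → Dec (Path F c)
Path? F [] = yes Path.[]
Path? F (x ∷ []) = yes ([-] x)
Path? F (x ∷ y ∷ c) = map′ (λ (a , p) → step a p) (λ { (step a p) → a , p }) (Adj? F x y ×-dec Path? F (y ∷ c))

Closing : ∀ {n} → Stream n → List (Fin n) → Set
Closing F c = ∃ λ x → ∃ λ y → head c ≡ just x × last c ≡ just y × Adj F y x

Closing? : ∀ {n} (F : Stream n) c → Dec (Closing F c)
Closing? F c with head c | last c
... | nothing | _ = no (λ { (_ , _ , () , _) })
... | just x | nothing = no (λ { (_ , _ , _ , () , _) })
... | just x | just y = map′ (λ a → x , y , refl , refl , a)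
      (λ (x' , y' , hd , lst , a) → subst₂ (Adj F) (sym (just-injective lst)) (sym (just-injective hd)) a)
      (Adj? F y x)

Cycle? : ∀ {n} (F : Stream n) c → Dec (Cycle F c)
Cycle? F c = map′ (λ (l , d , p , cl) → record { len≥3 = l ; distinct = d ; path = p ; closing = cl })
                  (λ cyc → Cycle.len≥3 cyc , Cycle.distinct cyc , Cycle.path cyc , Cycle.closing cyc)
                  ((3 ≤? length c) ×-dec unique? _≟F_ c ×-dec Path? F c ×-dec Closing? F c)

-- A cycle has distinct vertices, so it suffices to inspect lists of length ≤ n.
Acyclic? : ∀ {n} (F : Stream n) S → Dec (AcyclicWithout F S)
Acyclic? {n} F S = map′
  (λ no-cycle c cyc avoids → no-cycle (lose (lists-upto-complete n c (unique-fin-length-≤ (Cycle.distinct cyc))) (cyc , avoids)))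
  (λ acyclic some → let (c , _ , cyc , avoids) = find {P = λ c → Cycle F c × All (_∉ S) c} some in acyclic c cyc avoids)
  (¬? (any? (λ c → Cycle? F c ×-dec All.all? (λ x → ¬? (x ∈? S)) c) (lists-upto n)))

IsFVS? : ∀ {n} (F : Stream n) k S → Dec (IsFVS F k S)
IsFVS? F k S = (length S ≤? k) ×-dec Acyclic? F S

decide-fvs : ∀ {n} k (F : Stream n) → Σ (Maybe (List (Fin n))) (Correct k F)
decide-fvs k F with any? (IsFVS? F k) (lists-upto k)
... | yes some = let (S , _ , fvs) = find some in just S , fvs
... | no none = nothing , λ S fvs → none (lose (lists-upto-complete k S (proj₁ fvs)) fvs)

Adj-cons⁻ : ∀ {n} {e : Edge n} {F : Stream n} {x y} → Adj (e ∷ F) x y → Joins e x y ⊎ Adj F x y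
Adj-cons⁻ (_ , here refl , j) = inj₁ j
Adj-cons⁻ (f , there f∈F , j) = inj₂ (f , f∈F , j)

Adj-snoc⁻ : ∀ {n} {F : Stream n} {e : Edge n} {x y} → Adj (F ++ e ∷ []) x y → Adj F x y ⊎ Joins e x y
Adj-snoc⁻ {F = F} (f , f∈ , j) with ∈-++⁻ F f∈
... | inj₁ f∈F = inj₁ (f , f∈F , j)
... | inj₂ (here refl) = inj₂ j

⊆ᴬ-snoc : ∀ {n} {F : Stream n} {e : Edge n} → F ⊆ᴬ (F ++ e ∷ [])
⊆ᴬ-snoc = ⊆⇒⊆ᴬ ∈-++⁺ˡ

Joins⇒Adj-snoc : ∀ {n} {F : Stream n} {e : Edge n} {x y} → Joins e x y → Adj (F ++ e ∷ []) x y
Joins⇒Adj-snoc {F = F} {e} j = e , ∈-++⁺ʳ F (here refl) , j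

Joins⇒Adj : ∀ {n} {F : Stream n} {e : Edge n} → Adj F (u e) (v e) → ∀ {x y} → Joins e x y → Adj F x y
Joins⇒Adj a (inj₁ (refl , refl)) = a
Joins⇒Adj a (inj₂ (refl , refl)) = Adj-sym a

same-ends-Joins : ∀ {n} {e f : Edge n} → u e ≡ u f → v e ≡ v f → ∀ {x y} → Joins e x y → Joins f x y
same-ends-Joins refl refl j = j

decode-vertex : ∀ {n} → ℕ → Maybe (Fin n)
decode-vertex {n} a with a <? n
... | yes a<n = just (fromℕ< a<n)
... | no _ = nothing

decode-vertex-toℕ : ∀ {n} (i : Fin n) → decode-vertex (toℕ i) ≡ just i
decode-vertex-toℕ {n} i with toℕ i <? n
... | yes i<n = cong just (fromℕ<-toℕ i i<n)
... | no i≮n = ⊥-elim (i≮n (toℕ<n i))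

make-edge : ∀ {n} → Fin n → Fin n → Maybe (Edge n)
make-edge x y with x ≟F y
... | yes _ = nothing
... | no x≢y = just (edge x y x≢y)

decode-edge : ∀ {n} → ℕ → ℕ → Maybe (Edge n)
decode-edge a b with decode-vertex a | decode-vertex b
... | just x | just y = make-edge x y
... | _ | _ = nothing

decode : ∀ {n} → List ℕ → Stream n
decode (a ∷ b ∷ m) = maybe′ (_∷ decode m) (decode m) (decode-edge a b)
decode _ = []

decode-encoded : ∀ {n} (e : Edge n) (m : List ℕ) →
  ∃ λ e' → decode (toℕ (u e) ∷ toℕ (v e) ∷ m) ≡ e' ∷ decode m × u e' ≡ u e × v e' ≡ v e
decode-encoded e m rewrite decode-vertex-toℕ (u e) | decode-vertex-toℕ (v e) with u e ≟F v e
... | yes u≡v = ⊥-elim (u≢v e u≡v)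
... | no u≢v' = edge (u e) (v e) u≢v' , refl , refl , refl

module Algorithm (n k : ℕ) where

  capacity : ℕ
  capacity = n * suc k

  reject : List ℕ
  reject = 0 ∷ []

  insert : List ℕ → Edge n → List ℕ
  insert m e with Adj? (decode {n} m) (u e) (v e)
  ... | yes _ = m
  ... | no _ with length (decode {n} m) <? capacity
  ... | yes _ = toℕ (u e) ∷ toℕ (v e) ∷ m
  ... | no _ = reject

  update : List ℕ → Edge n → List ℕ
  update (w ∷ []) e = w ∷ []
  update m e = insert m e

  query : List ℕ → Maybe (List (Fin n))
  query (w ∷ []) = nothing
  query m = proj₁ (decide-fvs k (decode {n} m))

  algorithm : StreamAlg n
  algorithm = record { init = [] ; update = update ; query = query }

  record Live (s : Stream n) (m : List ℕ) : Set where
    field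
      complete    : s ⊆ᴬ decode m
      sound       : decode m ⊆ᴬ s
      simple      : Simple (decode {n} m)
      bounded     : length (decode {n} m) ≤ capacity
      two-words   : length m ≡ 2 * length (decode {n} m)
      vertex-words : All (_< n) m

  record Rejected (s : Stream n) (m : List ℕ) : Set where
    field
      is-reject   : m ≡ reject
      no-solution : ∀ S → ¬ IsFVS s k S
      nonempty    : 0 < n

  Invariant : Stream n → List ℕ → Set
  Invariant s m = Rejected s m ⊎ Live s m

  -- A live memory has even length, so it is never mistaken for `reject`.
  update-live : ∀ {s} m e → Live s m → update m e ≡ insert m e
  update-live [] e _ = refl
  update-live (w ∷ []) e live with () ← Live.two-words live
  update-live (w ∷ w' ∷ m) e _ = refl

  query-live : ∀ {s} m → Live s m → query m ≡ proj₁ (decide-fvs k (decode {n} m))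
  query-live [] _ = refl
  query-live (w ∷ []) live with () ← Live.two-words live
  query-live (w ∷ w' ∷ m) _ = refl

  -- Capacity is exhausted only for graphs without a solution: the stored
  -- edges plus the new one form a simple graph with n(k+1)+1 edges.
  insert-rejects : ∀ {s m e} → Live s m → ¬ Adj (decode m) (u e) (v e) → ¬ length (decode {n} m) < capacity →
    ∀ S → ¬ IsFVS (s ++ e ∷ []) k S
  insert-rejects {s} {m} {e} live new full S fvs =
    full (edges-bounded-by-fvs k (e ∷ decode m) S (Simple-cons e new (Live.simple live)) (FVS-antitone extended fvs))
    where
    extended : (e ∷ decode m) ⊆ᴬ (s ++ e ∷ [])
    extended a = [ Joins⇒Adj-snoc {F = s} , (λ a' → ⊆ᴬ-snoc (Live.sound live a')) ]′ (Adj-cons⁻ a)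

  live-via : ∀ {s m} (F : Stream n) → decode m ≡ F → s ⊆ᴬ F → F ⊆ᴬ s → Simple F →
    length F ≤ capacity → length m ≡ 2 * length F → All (_< n) m → Live s m
  live-via _ refl complete sound simple bounded two-words vertex-words =
    record { complete = complete ; sound = sound ; simple = simple ; bounded = bounded
           ; two-words = two-words ; vertex-words = vertex-words }

  insert-stores : ∀ {s m e} → Live s m → ¬ Adj (decode m) (u e) (v e) → length (decode {n} m) < capacity →
    Live (s ++ e ∷ []) (toℕ (u e) ∷ toℕ (v e) ∷ m)
  insert-stores {s} {m} {e} live new room with decode-encoded e m
  ... | e' , decodes , u≡ , v≡ = live-via (e' ∷ decode m) decodes
    (λ a → [ (λ a' → ⊆⇒⊆ᴬ there (Live.complete live a')) ,
             (λ j → e' , here refl , same-ends-Joins {e = e} {f = e'} (sym u≡) (sym v≡) j) ]′ (Adj-snoc⁻ a))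
    (λ a → [ (λ j → Joins⇒Adj-snoc {F = s} (same-ends-Joins {e = e'} {f = e} u≡ v≡ j)) ,
             (λ a' → ⊆ᴬ-snoc (Live.sound live a')) ]′ (Adj-cons⁻ a))
    (Simple-cons e' (subst₂ (λ x y → ¬ Adj (decode m) x y) (sym u≡) (sym v≡) new) (Live.simple live))
    room
    (trans (cong (λ l → suc (suc l)) (Live.two-words live)) (sym (*-suc 2 _)))
    (toℕ<n (u e) ∷ toℕ<n (v e) ∷ Live.vertex-words live)

  insert-preserves : ∀ {s m} e → Live s m → Invariant (s ++ e ∷ []) (insert m e)
  insert-preserves {s} {m} e live with Adj? (decode {n} m) (u e) (v e)
  ... | yes known = inj₂ (record
    { complete = λ a → [ Live.complete live , Joins⇒Adj {e = e} known ]′ (Adj-snoc⁻ a)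
    ; sound = λ a → ⊆ᴬ-snoc (Live.sound live a)
    ; simple = Live.simple live ; bounded = Live.bounded live
    ; two-words = Live.two-words live ; vertex-words = Live.vertex-words live })
  ... | no new with length (decode {n} m) <? capacity
  ... | yes room = inj₂ (insert-stores live new room)
  ... | no full = inj₁ (record { is-reject = refl ; no-solution = insert-rejects live new full
                               ; nonempty = n≢0⇒n>0 λ { refl → ¬Fin0 (u e) } })

  update-preserves : ∀ s m e → Invariant s m → Invariant (s ++ e ∷ []) (update m e)
  update-preserves s m e (inj₁ rejected) with Rejected.is-reject rejected
  ... | refl = inj₁ (record { is-reject = refl ; nonempty = Rejected.nonempty rejected
                             ; no-solution = λ S fvs → Rejected.no-solution rejected S (FVS-antitone ⊆ᴬ-snoc fvs) })
  update-preserves s m e (inj₂ live) rewrite update-live m e live = insert-preserves e live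

  run-preserves : ∀ s₀ m t → Invariant s₀ m → Invariant (s₀ ++ t) (foldl update m t)
  run-preserves s₀ m [] inv rewrite ++-identityʳ s₀ = inv
  run-preserves s₀ m (e ∷ t) inv =
    subst (λ s → Invariant s (foldl update (update m e) t)) (++-assoc s₀ (e ∷ []) t)
          (run-preserves (s₀ ++ e ∷ []) (update m e) t (update-preserves s₀ m e inv))

  initial : Invariant [] []
  initial = inj₂ (record { complete = λ a → a ; sound = λ a → a ; simple = []
                         ; bounded = z≤n ; two-words = refl ; vertex-words = [] })

  Correct-transfer : ∀ {s F : Stream n} → s ⊆ᴬ F → F ⊆ᴬ s → ∀ r → Correct k F r → Correct k s r
  Correct-transfer s⊆F F⊆s (just S) fvs = FVS-antitone s⊆F fvs
  Correct-transfer s⊆F F⊆s nothing none = λ S fvs → none S (FVS-antitone F⊆s fvs)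

  invariant-guarantees : ∀ s m → Invariant s m →
    length m ≤ 2 * n * suc k × All (_< suc n ^ 1) m × Correct k s (query m)
  invariant-guarantees s m (inj₁ rejected) with Rejected.is-reject rejected
  ... | refl = *-mono-≤ {1} {2 * n} {1} {suc k} (*-mono-≤ {1} {2} {1} {n} (s≤s z≤n) (Rejected.nonempty rejected)) (s≤s z≤n) ,
               s≤s z≤n ∷ [] , Rejected.no-solution rejected
  invariant-guarantees s m (inj₂ live) rewrite query-live m live =
    space , All.map word-bound (Live.vertex-words live) ,
    Correct-transfer (Live.complete live) (Live.sound live) _ (proj₂ (decide-fvs k (decode m)))
    where
    space : length m ≤ 2 * n * suc k
    space = begin
      length m                   ≡⟨ Live.two-words live ⟩
      2 * length (decode {n} m)  ≤⟨ *-monoʳ-≤ 2 (Live.bounded live) ⟩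
      2 * (n * suc k)            ≡⟨ *-assoc 2 n (suc k) ⟨
      2 * n * suc k              ∎
      where open ≤-Reasoning
    word-bound : ∀ {w} → w < n → w < suc n ^ 1
    word-bound w<n = subst (λ t → _ < suc t) (sym (*-identityʳ n)) (m<n⇒m<1+n w<n)

-- The algorithm uses at most 2n(k+1) words (C = 2), each below (n+1)^1 (c = 1).
theorem5 : ∃₂ λ (C c : ℕ) → ∀ (n k : ℕ) →
    ∃ λ (A : StreamAlg n) → IsPSA-FVS k C c A
theorem5 = 2 , 1 , λ n k → let open Algorithm n k in
  algorithm , λ s → invariant-guarantees s _ (run-preserves [] [] s initial)
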